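{- Let $f(t) = \sum_{n=0}^{\infty} a_n \frac{t^n}{n!} \in \mathbb{Q}[[t]]$ with $a_n \in \mathbb{Z}$ for all $n \in \mathbb{N}$ and $a_0 \neq 0$. Then the formal power series $\frac{a_0}{f(a_0 t)}$, written as $\sum_{n=0}^\infty c_n \frac{t^n}{n!}$, has $c_n \in \mathbb{Z}$ for all $n \in \mathbb{N}$.
   Context: $\mathbb{Q}[[t]]$ denotes the ring of formal power series in $t$ with rational coefficients; since $a_0 \neq 0$, $f(a_0 t)$ is invertible in $\mathbb{Q}[[t]]$. -}

module Defs where

open import Data.Nat using (ℕ; zero; suc; _∸_; _!)
open import Data.Nat.Properties using (_!≢0)
open import Data.Integer using (ℤ)
open import Data.Rational using (ℚ; _+_; _*_; _/_; 0ℚ)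
import Data.Integer as ℤ

-- A formal power series in t over ℚ, given by its coefficient sequence:
-- F represents Σₙ F n · tⁿ.
-- integer embedded in ℚ
ιℤ : ℤ → ℚ
ιℤ z = z / 1

Series : Set
Series = ℕ → ℚ

sumUpTo : (ℕ → ℚ) → ℕ → ℚ
sumUpTo h zero    = h zero
sumUpTo h (suc n) = sumUpTo h n + h (suc n)

_·ₛ_ : Series → Series → Series
(F ·ₛ G) n = sumUpTo (λ k → F k * G (n ∸ k)) n

constₛ : ℚ → Series
constₛ x zero    = x
constₛ x (suc n) = 0ℚ

rescale : ℤ → Series → Series
rescale c F n = ιℤ (c ℤ.^ n) * F n

egf : (ℕ → ℤ) → Series
egf a n = (a n / (n !)) {{n !≢0}}

{-# OPTIONS --safe #-}
-- Comparing coefficients of tⁿ (n ≥ 1) in f(a₀t) · g(t) = a₀ gives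
-- a₀ gₙ = - Σ_{k=1}^{n} a₀ᵏ (a_k / k!) g_{n-k}, and every term on the right carries a factor a₀, which
-- cancels.  If g_j = c_j / j! with c_j ∈ ℤ for all j < n, then (a_k / k!) (c_{n-k} / (n-k)!) equals
-- binom(n,k) a_k c_{n-k} / n!, so gₙ has the same form; strong induction on n finishes the proof.
module Submission where

open import Defs
open import Data.Nat using (ℕ; NonZero; _!; zero; suc; _∸_; _<_; _≤_; s≤s; z≤n)
import Data.Nat as ℕ
open import Data.Nat.Properties using (_!≢0; _!*_!≢0)
import Data.Nat.Properties as ℕ
open import Data.Nat.Combinatorics using (_C_; nCk≡n!/k![n-k]!; k![n∸k]!∣n!)
open import Data.Nat.DivMod using (m*[n/m]≡n)
open import Data.Nat.Induction using (<-rec)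
open import Data.Integer using (ℤ; +_)
import Data.Integer as ℤ
import Data.Integer.Properties as ℤ
open import Data.Integer.Solver using (module +-*-Solver)
open import Data.Rational using (ℚ; _/_; 0ℚ; 1ℚ; _+_; _*_; -_; 1/_; toℚᵘ; ≢-nonZero)
open import Data.Rational.Properties
  using (toℚᵘ-injective; toℚᵘ-fromℚᵘ; toℚᵘ-homo-*; toℚᵘ-homo-+; toℚᵘ-homo‿-;
         *-assoc; *-identityˡ; *-identityʳ; *-inverseˡ; *-distribˡ-+; *-zeroʳ; +-assoc; +-0-group)
open import Data.Rational.Unnormalised as ᵘ using (mkℚᵘ; _≃_; *≡*) renaming (_/_ to _/ᵘ_)
import Data.Rational.Unnormalised.Properties as ᵘ
open import Algebra.Properties.Group +-0-group using (inverseˡ-unique)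
open import Data.Product using (∃; _,_)
open import Function using (_∘_)
open import Relation.Binary.PropositionalEquality
  using (_≡_; _≢_; refl; sym; trans; cong; cong₂; subst; module ≡-Reasoning)

toℚᵘ-/ : ∀ x d .{{_ : NonZero d}} → toℚᵘ (x / d) ≃ (x /ᵘ d)
toℚᵘ-/ x (suc d) = toℚᵘ-fromℚᵘ (mkℚᵘ x d)

≃ᵘ⇒≡/ : ∀ p x d .{{_ : NonZero d}} → toℚᵘ p ≃ (x /ᵘ d) → p ≡ x / d
≃ᵘ⇒≡/ p x d p≃x/d = toℚᵘ-injective (ᵘ.≃-trans p≃x/d (ᵘ.≃-sym (toℚᵘ-/ x d)))

/-cross : ∀ x y p q .{{_ : NonZero p}} .{{_ : NonZero q}} → x ℤ.* + q ≡ y ℤ.* + p → x / p ≡ y / q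
/-cross x y p@(suc _) (suc q) eq = ≃ᵘ⇒≡/ (x / p) y (suc q) (ᵘ.≃-trans (toℚᵘ-/ x p) (*≡* eq))

/ᵘ-*-/ᵘ : ∀ x y p q .{{_ : NonZero p}} .{{_ : NonZero q}} →
          (x /ᵘ p) ᵘ.* (y /ᵘ q) ≡ ((x ℤ.* y) /ᵘ (p ℕ.* q)) {{ℕ.m*n≢0 p q}}
/ᵘ-*-/ᵘ x y (suc p) (suc q) = refl

/-*-/ : ∀ x y p q .{{_ : NonZero p}} .{{_ : NonZero q}} →
        (x / p) * (y / q) ≡ ((x ℤ.* y) / (p ℕ.* q)) {{ℕ.m*n≢0 p q}}
/-*-/ x y p q = ≃ᵘ⇒≡/ _ (x ℤ.* y) (p ℕ.* q) {{ℕ.m*n≢0 p q}} (ᵘ.≃-trans (toℚᵘ-homo-* (x / p) (y / q))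
  (ᵘ.≃-trans (ᵘ.*-cong (toℚᵘ-/ x p) (toℚᵘ-/ y q)) (ᵘ.≃-reflexive (/ᵘ-*-/ᵘ x y p q))))

/ᵘ-+-/ᵘ : ∀ x y d .{{_ : NonZero d}} → (x /ᵘ d) ᵘ.+ (y /ᵘ d) ≃ (x ℤ.+ y) /ᵘ d
/ᵘ-+-/ᵘ x y (suc d) = *≡* (begin
    (x ℤ.* D ℤ.+ y ℤ.* D) ℤ.* D      ≡⟨ solve 3 (λ x y D → (x :* D :+ y :* D) :* D := (x :+ y) :* (D :* D)) refl x y D ⟩
    (x ℤ.+ y) ℤ.* (D ℤ.* D)          ≡⟨ cong ((x ℤ.+ y) ℤ.*_) (ℤ.pos-* (suc d) (suc d)) ⟨
    (x ℤ.+ y) ℤ.* + (suc d ℕ.* suc d) ∎)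
  where
  open ≡-Reasoning
  open +-*-Solver
  D = + suc d

/-+-/ : ∀ x y d .{{_ : NonZero d}} → (x / d) + (y / d) ≡ (x ℤ.+ y) / d
/-+-/ x y d = ≃ᵘ⇒≡/ _ (x ℤ.+ y) d (ᵘ.≃-trans (toℚᵘ-homo-+ (x / d) (y / d))
  (ᵘ.≃-trans (ᵘ.+-cong (toℚᵘ-/ x d) (toℚᵘ-/ y d)) (/ᵘ-+-/ᵘ x y d)))

-‿/ᵘ : ∀ x d .{{_ : NonZero d}} → ᵘ.- (x /ᵘ d) ≡ (ℤ.- x) /ᵘ d
-‿/ᵘ x (suc d) = refl

-‿/ : ∀ x d .{{_ : NonZero d}} → - (x / d) ≡ (ℤ.- x) / d
-‿/ x d = ≃ᵘ⇒≡/ _ (ℤ.- x) d (ᵘ.≃-trans (toℚᵘ-homo‿- (x / d))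
  (ᵘ.≃-trans (ᵘ.-‿cong (toℚᵘ-/ x d)) (ᵘ.≃-reflexive (-‿/ᵘ x d))))

ιℤ-* : ∀ x y → ιℤ (x ℤ.* y) ≡ ιℤ x * ιℤ y
ιℤ-* x y = sym (/-*-/ x y 1 1)

ιℤ-*-/ : ∀ z x d .{{_ : NonZero d}} → ιℤ z * (x / d) ≡ (z ℤ.* x) / d
ιℤ-*-/ z x d = trans (/-*-/ z x 1 d) (/-cross (z ℤ.* x) (z ℤ.* x) (1 ℕ.* d) d {{ℕ.m*n≢0 1 d}}
  (cong (λ e → z ℤ.* x ℤ.* + e) (sym (ℕ.*-identityˡ d))))

ιℤ-injective : ∀ {x y} → ιℤ x ≡ ιℤ y → x ≡ y
ιℤ-injective {x} {y} ιx≡ιy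
  with ᵘ.≃-trans (ᵘ.≃-sym (toℚᵘ-/ x 1)) (ᵘ.≃-trans (ᵘ.≃-reflexive (cong toℚᵘ ιx≡ιy)) (toℚᵘ-/ y 1))
... | *≡* x*1≡y*1 = trans (sym (ℤ.*-identityʳ x)) (trans x*1≡y*1 (ℤ.*-identityʳ y))

*-cancelˡ-≡ : ∀ x {y z} → x ≢ 0ℚ → x * y ≡ x * z → y ≡ z
*-cancelˡ-≡ x {y} {z} x≢0 x*y≡x*z = begin
    y                  ≡⟨ sym (*-identityˡ y) ⟩
    1ℚ * y             ≡⟨ cong (_* y) (sym (*-inverseˡ x)) ⟩
    (1/ x) * x * y     ≡⟨ *-assoc (1/ x) x y ⟩
    (1/ x) * (x * y)   ≡⟨ cong ((1/ x) *_) x*y≡x*z ⟩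
    (1/ x) * (x * z)   ≡⟨ *-assoc (1/ x) x z ⟨
    (1/ x) * x * z     ≡⟨ cong (_* z) (*-inverseˡ x) ⟩
    1ℚ * z             ≡⟨ *-identityˡ z ⟩
    z                  ∎
  where
  open ≡-Reasoning
  instance _ = ≢-nonZero x≢0

x*y+x*z≡0⇒y≡-z : ∀ {x y z} → x ≢ 0ℚ → x * y + x * z ≡ 0ℚ → y ≡ - z
x*y+x*z≡0⇒y≡-z {x} {y} {z} x≢0 x*y+x*z≡0 = inverseˡ-unique y z (*-cancelˡ-≡ x x≢0 (begin
    x * (y + z)    ≡⟨ *-distribˡ-+ x y z ⟩
    x * y + x * z  ≡⟨ x*y+x*z≡0 ⟩
    0ℚ             ≡⟨ *-zeroʳ x ⟨
    x * 0ℚ         ∎))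
  where open ≡-Reasoning

sumUpTo-suc : ∀ h n → sumUpTo h (suc n) ≡ h 0 + sumUpTo (h ∘ suc) n
sumUpTo-suc h zero    = refl
sumUpTo-suc h (suc n) = trans (cong (_+ h (suc (suc n))) (sumUpTo-suc h n))
  (+-assoc (h 0) (sumUpTo (h ∘ suc) n) (h (suc (suc n))))

sumUpTo-cong : ∀ {h h′} → (∀ k → h k ≡ h′ k) → ∀ n → sumUpTo h n ≡ sumUpTo h′ n
sumUpTo-cong h≗h′ zero    = h≗h′ 0
sumUpTo-cong h≗h′ (suc n) = cong₂ _+_ (sumUpTo-cong h≗h′ n) (h≗h′ (suc n))

sumUpTo-*ˡ : ∀ x h n → sumUpTo (λ k → x * h k) n ≡ x * sumUpTo h n
sumUpTo-*ˡ x h zero    = refl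
sumUpTo-*ˡ x h (suc n) = trans (cong (_+ x * h (suc n)) (sumUpTo-*ˡ x h n))
  (sym (*-distribˡ-+ x (sumUpTo h n) (h (suc n))))

rescale-zero : ∀ c F → rescale c F 0 ≡ F 0
rescale-zero c F = *-identityˡ (F 0)

rescale-suc : ∀ c F k → rescale c F (suc k) ≡ ιℤ c * rescale c (F ∘ suc) k
rescale-suc c F k = trans (cong (_* F (suc k)) (ιℤ-* c (c ℤ.^ k))) (*-assoc (ιℤ c) (ιℤ (c ℤ.^ k)) (F (suc k)))

rescale-·ₛ-suc : ∀ c F G m →
  (rescale c F ·ₛ G) (suc m) ≡ F 0 * G (suc m) + ιℤ c * (rescale c (F ∘ suc) ·ₛ G) m
rescale-·ₛ-suc c F G m = begin
    (rescale c F ·ₛ G) (suc m)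
      ≡⟨ sumUpTo-suc (λ k → rescale c F k * G (suc m ∸ k)) m ⟩
    rescale c F 0 * G (suc m) + sumUpTo (λ k → rescale c F (suc k) * G (m ∸ k)) m
      ≡⟨ cong₂ _+_ (cong (_* G (suc m)) (rescale-zero c F)) (sumUpTo-cong factor-c m) ⟩
    F 0 * G (suc m) + sumUpTo (λ k → ιℤ c * (rescale c (F ∘ suc) k * G (m ∸ k))) m
      ≡⟨ cong (λ s → F 0 * G (suc m) + s) (sumUpTo-*ˡ (ιℤ c) (λ k → rescale c (F ∘ suc) k * G (m ∸ k)) m) ⟩
    F 0 * G (suc m) + ιℤ c * (rescale c (F ∘ suc) ·ₛ G) m
      ∎
  where
  open ≡-Reasoning
  factor-c : ∀ k → rescale c F (suc k) * G (m ∸ k) ≡ ιℤ c * (rescale c (F ∘ suc) k * G (m ∸ k))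
  factor-c k = trans (cong (_* G (m ∸ k)) (rescale-suc c F k)) (*-assoc (ιℤ c) (rescale c (F ∘ suc) k) (G (m ∸ k)))

HasDenominator : (d : ℕ) .{{_ : NonZero d}} → ℚ → Set
HasDenominator d x = ∃ λ c → x ≡ c / d

module _ {d : ℕ} .{{_ : NonZero d}} where

  HasDenominator-+ : ∀ {x y} → HasDenominator d x → HasDenominator d y → HasDenominator d (x + y)
  HasDenominator-+ (c , refl) (c′ , refl) = c ℤ.+ c′ , /-+-/ c c′ d

  HasDenominator-neg : ∀ {x} → HasDenominator d x → HasDenominator d (- x)
  HasDenominator-neg (c , refl) = ℤ.- c , -‿/ c d

  HasDenominator-ιℤ* : ∀ z {x} → HasDenominator d x → HasDenominator d (ιℤ z * x)
  HasDenominator-ιℤ* z (c , refl) = z ℤ.* c , ιℤ-*-/ z c d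

  HasDenominator-sumUpTo : ∀ h n → (∀ k → k ≤ n → HasDenominator d (h k)) → HasDenominator d (sumUpTo h n)
  HasDenominator-sumUpTo h zero    hᵏ = hᵏ 0 z≤n
  HasDenominator-sumUpTo h (suc n) hᵏ = HasDenominator-+
    (HasDenominator-sumUpTo h n (λ k k≤n → hᵏ k (ℕ.m≤n⇒m≤1+n k≤n))) (hᵏ (suc n) ℕ.≤-refl)

binomial*factorials≡factorial : ∀ {n k} → k ≤ n → (n C k) ℕ.* (k ! ℕ.* (n ∸ k) !) ≡ n !
binomial*factorials≡factorial {n} {k} k≤n = begin
    (n C k) ℕ.* (k ! ℕ.* (n ∸ k) !)                      ≡⟨ ℕ.*-comm (n C k) (k ! ℕ.* (n ∸ k) !) ⟩
    k ! ℕ.* (n ∸ k) ! ℕ.* (n C k)                        ≡⟨ cong (k ! ℕ.* (n ∸ k) ! ℕ.*_) (nCk≡n!/k![n-k]! k≤n) ⟩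
    k ! ℕ.* (n ∸ k) ! ℕ.* (n ! ℕ./ (k ! ℕ.* (n ∸ k) !))  ≡⟨ m*[n/m]≡n (k![n∸k]!∣n! k≤n) ⟩
    n !                                                  ∎
  where
  open ≡-Reasoning
  instance _ = k !* (n ∸ k) !≢0

HasDenominator-factorial-* : ∀ {n k x y} → k ≤ n →
  HasDenominator (k !) {{k !≢0}} x → HasDenominator ((n ∸ k) !) {{(n ∸ k) !≢0}} y →
  HasDenominator (n !) {{n !≢0}} (x * y)
HasDenominator-factorial-* {n} {k} k≤n (c , refl) (c′ , refl) = + (n C k) ℤ.* (c ℤ.* c′) ,
  trans (/-*-/ c c′ (k !) ((n ∸ k) !) {{k !≢0}} {{(n ∸ k) !≢0}})
        (/-cross (c ℤ.* c′) (+ (n C k) ℤ.* (c ℤ.* c′)) (k ! ℕ.* (n ∸ k) !) (n !)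
                 {{k !* (n ∸ k) !≢0}} {{n !≢0}} cross)
  where
  open ≡-Reasoning
  open +-*-Solver
  F = k ! ℕ.* (n ∸ k) !
  cross : c ℤ.* c′ ℤ.* + (n !) ≡ + (n C k) ℤ.* (c ℤ.* c′) ℤ.* + F
  cross = begin
    c ℤ.* c′ ℤ.* + (n !)              ≡⟨ cong (λ m → c ℤ.* c′ ℤ.* + m) (binomial*factorials≡factorial k≤n) ⟨
    c ℤ.* c′ ℤ.* + ((n C k) ℕ.* F)    ≡⟨ cong (c ℤ.* c′ ℤ.*_) (ℤ.pos-* (n C k) F) ⟩
    c ℤ.* c′ ℤ.* (+ (n C k) ℤ.* + F)  ≡⟨ solve 3 (λ x b f → x :* (b :* f) := b :* x :* f) refl (c ℤ.* c′) (+ (n C k)) (+ F) ⟩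
    + (n C k) ℤ.* (c ℤ.* c′) ℤ.* + F  ∎

corollary1 : (a : ℕ → ℤ) → a 0 ≢ + 0 →
    (g : Series) →
    (∀ n → (rescale (a 0) (egf a) ·ₛ g) n ≡ constₛ (ιℤ (a 0)) n) →
    ∀ n → ∃ λ (c : ℤ) → g n ≡ (c / (n !)) {{n !≢0}}
corollary1 a a₀≢0 g fg≡a₀ = <-rec (λ n → HasDenominator (n !) {{n !≢0}} (g n)) coefficient
  where
  A = a 0
  ιA≢0 : ιℤ A ≢ 0ℚ
  ιA≢0 = a₀≢0 ∘ ιℤ-injective

  g-suc : ∀ m → g (suc m) ≡ - (rescale A (egf a ∘ suc) ·ₛ g) m
  g-suc m = x*y+x*z≡0⇒y≡-z ιA≢0 (trans (sym (rescale-·ₛ-suc A (egf a) g m)) (fg≡a₀ (suc m)))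

  coefficient : ∀ n → (∀ {j} → j < n → HasDenominator (j !) {{j !≢0}} (g j)) →
                HasDenominator (n !) {{n !≢0}} (g n)
  coefficient zero    _  = + 1 , *-cancelˡ-≡ (ιℤ A) ιA≢0 (begin
      ιℤ A * g 0                  ≡⟨ cong (_* g 0) (rescale-zero A (egf a)) ⟨
      rescale A (egf a) 0 * g 0   ≡⟨ fg≡a₀ 0 ⟩
      ιℤ A                        ≡⟨ *-identityʳ (ιℤ A) ⟨
      ιℤ A * 1ℚ                   ∎)
    where open ≡-Reasoning
  coefficient (suc m) ih = subst (HasDenominator (suc m !)) (sym (g-suc m))
    (HasDenominator-neg (HasDenominator-sumUpTo _ m term))
    where
    instance _ = suc m !≢0
    term : ∀ k → k ≤ m → HasDenominator (suc m !) (rescale A (egf a ∘ suc) k * g (m ∸ k))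
    term k k≤m = HasDenominator-factorial-* (s≤s k≤m)
      (HasDenominator-ιℤ* {{suc k !≢0}} (A ℤ.^ k) (a (suc k) , refl)) (ih (s≤s (ℕ.m∸n≤m m k)))
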